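{- For all positive integers $n,m$ we have $R(n,m)\subseteq R(n+1,m)$.
   Context: A complementary alphabet of size $m$ is a set consisting of $m$ pairs of complementary letters $\{A,\bar{A},B,\bar{B},\ldots\}$; $\bar{A}$ is the complement of $A$ and $A$ is the complement of $\bar{A}$. Let $T$ be a rooted plane tree with $n$ edges and $P=p_1p_2\ldots p_{2n}$ a word over a complementary alphabet. Label the edges of $T$ by the letters of $P$ in order along a counter-clockwise walk around the boundary of $T$ starting at the root, so that every edge receives two letters (one when the walk traverses it going down, one going up). $T$ is called $P$-valid if every edge receives a pair of complementary letters. Let $V(P)$ denote the set of $P$-valid rooted plane trees with $n$ edges. Let $\mathcal{P}(n,m)$ be the set of words $P$ of length $2n$ over a complementary alphabet of size $m$ having at least one $P$-valid plane tree, and let $R(n,m)$ be the set of positive integers $k$ such that there exists $P\in\mathcal{P}(n,m)$ with $|V(P)|=k$. -}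

module Defs where

open import Data.Nat using (ℕ; zero; suc; _+_; _*_; _≤_)
open import Data.Fin using (Fin)
open import Data.Bool using (Bool; not)
open import Data.Product using (_×_; _,_; Σ; ∃; ∃-syntax)
open import Data.List using (List; []; _∷_; _++_; length)
open import Data.List.Relation.Unary.Unique.Propositional using (Unique)
open import Data.List.Membership.Propositional using (_∈_)
open import Data.Vec using (Vec; toList)
open import Function.Bundles using (_⇔_)
open import Relation.Binary.PropositionalEquality using (_≡_)

-- Complementary alphabet of size m: letters are pairs (i , b), with i : Fin m
-- naming the pair and b distinguishing A from Ā.
Letter : ℕ → Set
Letter m = Fin m × Bool

comp : ∀ {m} → Letter m → Letter m
comp (i , b) = (i , not b)

data Tree : Set where
  node : List Tree → Tree

mutual
  edges : Tree → ℕ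
  edges (node ts) = edgesF ts

  edgesF : List Tree → ℕ
  edgesF [] = 0
  edgesF (t ∷ ts) = suc (edges t + edgesF ts)

-- Labelling along the counter-clockwise boundary walk starting at the root:
-- for each child (in order) the walk goes down the edge to that child
-- (reading one letter a), walks around the child's subtree, then comes back
-- up the same edge (reading one letter b).
mutual
  ValidT : ∀ {m} → Tree → List (Letter m) → Set
  ValidT (node ts) w = ValidF ts w

  data ValidF {m : ℕ} : List Tree → List (Letter m) → Set where
    vnil  : ValidF [] []
    vcons : ∀ {t ts} (a : Letter m) (w₁ w₂ : List (Letter m)) →
            ValidT t w₁ → ValidF ts w₂ →
            ValidF (t ∷ ts) (a ∷ (w₁ ++ (comp a ∷ w₂)))

PValid : ∀ {m} n → Vec (Letter m) (2 * n) → Tree → Set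
PValid n P T = (edges T ≡ n) × ValidT T (toList P)

-- |V(P)| = k : there is a duplicate-free list of k trees which are exactly
-- the P-valid rooted plane trees with n edges.
CardV≡ : ∀ {m} n → Vec (Letter m) (2 * n) → ℕ → Set
CardV≡ n P k = Σ (List Tree) λ L →
  Unique L × (length L ≡ k) × (∀ T → (T ∈ L) ⇔ PValid n P T)

-- k ∈ R(n,m): k positive and some word P of length 2n over the alphabet of
-- size m has |V(P)| = k (k ≥ 1 forces P ∈ 𝒫(n,m)).
InR : ℕ → ℕ → ℕ → Set
InR n m k = (1 ≤ k) × ∃[ P ] CardV≡ {m} n P k

-- Fix a letter x and read a word as a lattice path: x steps down, x̄ steps
-- up (all other letters are flat).  Cut P = L ++ R at a global minimum of
-- this height profile, i.e. no suffix of L climbs and no prefix of R dips,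
-- and put P' = L ++ x x̄ ++ R.  Then the P'-valid trees are exactly the
-- P-valid trees with a new leaf edge labelled x x̄ inserted at the boundary
-- position |L|:
--   * inserting a leaf keeps validity, for any cut and any letter;
--   * conversely, in a P'-valid tree the inserted x cannot close an edge and
--     the inserted x̄ cannot open one, since the letters in between would form
--     a balanced word (valid words contain as many y as ȳ) preceded by x̄,
--     which climbs - impossible inside L resp. at the start of R.
-- Leaf insertion is injective, so a duplicate-free enumeration of V(P) is
-- carried to one of V(P') of the same length.
module Submission where

open import Defs
open import Data.Nat using (ℕ; zero; suc; _+_; _*_; _∸_; _≤_; _<_; z≤n; s≤s; _≤?_)
open import Data.Nat.Properties
open import Data.Nat.Tactic.RingSolver using (solve-∀)
import Data.Fin as Fin
open import Data.Bool using (false)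
import Data.Bool as Bool
open import Data.Bool.Properties using (not-¬; not-involutive)
open import Data.Product using (_×_; _,_; Σ; ∃-syntax; proj₁; proj₂)
open import Data.Product.Properties using (≡-dec; ,-injectiveʳ)
open import Data.Sum using (_⊎_; inj₁; inj₂)
open import Data.Empty using (⊥-elim)
open import Data.List using (List; []; _∷_; _++_; length; map; [_])
open import Data.Nat.ListAction using (sum)
open import Data.Nat.ListAction.Properties using (sum-++)
open import Data.List.Properties
  using (++-assoc; ++-identityʳ; length-++; length-map; map-++; ∷-injective; ∷-injectiveˡ; ∷-injectiveʳ)
open import Data.List.Membership.Propositional using (_∈_)
open import Data.List.Membership.Propositional.Properties using (∈-map⁺; ∈-map⁻)
open import Data.List.Relation.Unary.Unique.Propositional using (Unique)
import Data.List.Relation.Unary.Unique.Propositional.Properties as Unique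
open import Data.Vec using (Vec; toList)
import Data.Vec as Vec
open import Data.Vec.Properties using (length-toList)
open import Function using (_∘′_)
open import Function.Bundles using (_⇔_; mk⇔; Equivalence)
open import Relation.Binary.Definitions using (DecidableEquality)
open import Relation.Binary.PropositionalEquality
  using (_≡_; _≢_; refl; sym; trans; cong; cong₂; subst; subst₂; module ≡-Reasoning)
open import Relation.Nullary using (¬_; yes; no; contradiction)

private variable
  A : Set
  m : ℕ

levi : (xs ys us vs : List A) → xs ++ ys ≡ us ++ vs →
  (∃[ M ] (us ≡ xs ++ M) × (ys ≡ M ++ vs)) ⊎ (∃[ M ] (xs ≡ us ++ M) × (vs ≡ M ++ ys))
levi [] ys us vs e = inj₁ (us , refl , e)
levi (x ∷ xs) ys [] vs e = inj₂ (x ∷ xs , refl , sym e)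
levi (x ∷ xs) ys (u ∷ us) vs e with ∷-injective e
... | refl , e′ with levi xs ys us vs e′
... | inj₁ (M , p , q) = inj₁ (M , cong (x ∷_) p , q)
... | inj₂ (M , p , q) = inj₂ (M , cong (x ∷_) p , q)

cut-around : ∀ (w₁ : List A) c w₂ L R → w₁ ++ c ∷ w₂ ≡ L ++ R →
  (∃[ M ] (L ≡ w₁ ++ c ∷ M) × (w₂ ≡ M ++ R)) ⊎ (∃[ M ] (w₁ ≡ L ++ M) × (R ≡ M ++ c ∷ w₂))
cut-around w₁ c w₂ L R e with levi w₁ (c ∷ w₂) L R e
... | inj₂ (M , p , q) = inj₂ (M , p , q)
... | inj₁ ([] , refl , q) = inj₂ ([] , sym (trans (++-identityʳ _) (++-identityʳ w₁)) , sym q)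
... | inj₁ (d ∷ M , p , q) with ∷-injective q
...   | refl , q′ = inj₁ (M , p , q′)

data PairCut (w₁ : List A) (c : A) (w₂ L : List A) (y z : A) (R : List A) : Set where
  pair-after  : ∀ M → L ≡ w₁ ++ c ∷ M → w₂ ≡ M ++ y ∷ z ∷ R → PairCut w₁ c w₂ L y z R
  pair-before : ∀ M → w₁ ≡ L ++ y ∷ z ∷ M → R ≡ M ++ c ∷ w₂ → PairCut w₁ c w₂ L y z R
  c-is-z      : w₁ ≡ L ++ [ y ] → c ≡ z → w₂ ≡ R → PairCut w₁ c w₂ L y z R
  c-is-y      : w₁ ≡ L → c ≡ y → w₂ ≡ z ∷ R → PairCut w₁ c w₂ L y z R

cut-around-pair : ∀ (w₁ : List A) c w₂ L y z R → w₁ ++ c ∷ w₂ ≡ L ++ y ∷ z ∷ R →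
  PairCut w₁ c w₂ L y z R
cut-around-pair w₁ c w₂ L y z R e with cut-around w₁ c w₂ L (y ∷ z ∷ R) e
... | inj₁ (M , p , q) = pair-after M p q
... | inj₂ ([] , p , q) with ∷-injective q
...   | y≡c , q′ = c-is-y (trans p (++-identityʳ L)) (sym y≡c) (sym q′)
cut-around-pair w₁ c w₂ L y z R e | inj₂ (d ∷ [] , p , q) with ∷-injective q
... | refl , q′ with ∷-injective q′
...   | z≡c , R≡w₂ = c-is-z p (sym z≡c) (sym R≡w₂)
cut-around-pair w₁ c w₂ L y z R e | inj₂ (d ∷ d′ ∷ M , p , q) with ∷-injective q
... | refl , q′ with ∷-injective q′
...   | refl , q″ = pair-before M p q″

vcons≡ : ∀ {t ts} {w : List (Letter m)} a {w₁ w₂} → ValidT t w₁ → ValidF ts w₂ →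
  a ∷ w₁ ++ comp a ∷ w₂ ≡ w → ValidF (t ∷ ts) w
vcons≡ a vt vf refl = vcons a _ _ vt vf

_≟ℓ_ : DecidableEquality (Letter m)
_≟ℓ_ = ≡-dec Fin._≟_ Bool._≟_

comp-involutive : ∀ {a : Letter m} → comp (comp a) ≡ a
comp-involutive {a = i , b} = cong (i ,_) (not-involutive b)

comp-swap : ∀ {a b : Letter m} → comp a ≡ b → a ≡ comp b
comp-swap p = trans (sym comp-involutive) (cong comp p)

occ : Letter m → Letter m → ℕ
occ y a with a ≟ℓ y
... | yes _ = 1
... | no _ = 0

occ-self : ∀ (y : Letter m) → occ y y ≡ 1
occ-self y with y ≟ℓ y
... | yes _ = refl
... | no y≢y = contradiction refl y≢y

occ-comp-self : ∀ (y : Letter m) → occ y (comp y) ≡ 0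
occ-comp-self y with comp y ≟ℓ y
... | no _ = refl
... | yes p = ⊥-elim (not-¬ refl (sym (,-injectiveʳ p)))

occ-comp : ∀ (y a : Letter m) → occ y (comp a) ≡ occ (comp y) a
occ-comp y a with comp a ≟ℓ y | a ≟ℓ comp y
... | yes _ | yes _ = refl
... | no _ | no _ = refl
... | yes p | no ¬q = contradiction (comp-swap p) ¬q
... | no ¬p | yes q = contradiction (trans (cong comp q) comp-involutive) ¬p

count : Letter m → List (Letter m) → ℕ
count y w = sum (map (occ y) w)

count-++ : ∀ (y : Letter m) u v → count y (u ++ v) ≡ count y u + count y v
count-++ y u v = trans (cong sum (map-++ (occ y) u v)) (sum-++ (map (occ y) u) _)

count-cons-self : ∀ (y : Letter m) w → count y (y ∷ w) ≡ suc (count y w)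
count-cons-self y w = cong (_+ count y w) (occ-self y)

count-cons-comp : ∀ (y : Letter m) w → count y (comp y ∷ w) ≡ count y w
count-cons-comp y w = cong (_+ count y w) (occ-comp-self y)

-- Every valid word is balanced: each edge carries one a and one ā, so
-- a letter y occurs as often as ȳ.
balanced : ∀ (y : Letter m) {ts w} → ValidF ts w → count y w ≡ count (comp y) w
balanced y vnil = refl
balanced y (vcons {node cs} a w₁ w₂ vt vf) = begin
  count y (a ∷ w₁ ++ comp a ∷ w₂)
    ≡⟨ cong (occ y a +_) (count-++ y w₁ (comp a ∷ w₂)) ⟩
  occ y a + (count y w₁ + (occ y (comp a) + count y w₂))
    ≡⟨ cong₂ (λ u v → occ y a + (u + v)) (balanced y vt) (cong₂ _+_ (occ-comp y a) (balanced y vf)) ⟩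
  occ y a + (count ȳ w₁ + (occ ȳ a + count ȳ w₂))
    ≡⟨ swap (occ y a) (count ȳ w₁) (occ ȳ a) (count ȳ w₂) ⟩
  occ ȳ a + (count ȳ w₁ + (occ y a + count ȳ w₂))
    ≡⟨ cong (λ u → occ ȳ a + (count ȳ w₁ + (u + count ȳ w₂))) y-as-ȳ ⟩
  occ ȳ a + (count ȳ w₁ + (occ ȳ (comp a) + count ȳ w₂))
    ≡⟨ cong (occ ȳ a +_) (count-++ ȳ w₁ (comp a ∷ w₂)) ⟨
  count ȳ (a ∷ w₁ ++ comp a ∷ w₂) ∎
  where
  open ≡-Reasoning
  ȳ = comp y
  y-as-ȳ : occ y a ≡ occ ȳ (comp a)
  y-as-ȳ = trans (cong (λ z → occ z a) (sym comp-involutive)) (sym (occ-comp ȳ a))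
  swap : ∀ p X q Y → p + (X + (q + Y)) ≡ q + (X + (p + Y))
  swap = solve-∀

boundary : List Tree → ℕ
boundary [] = 0
boundary (node cs ∷ ts) = suc (boundary cs + suc (boundary ts))

word-length : ∀ {ts} {w : List (Letter m)} → ValidF ts w → length w ≡ boundary ts
word-length vnil = refl
word-length (vcons {node cs} a w₁ w₂ vt vf) =
  cong suc (trans (length-++ w₁) (cong₂ (λ p q → p + suc q) (word-length vt) (word-length vf)))

leaf : Tree
leaf = node []

-- insertLeaf g ts adds a leaf edge whose two letters are read right after the
-- first g letters of the boundary walk.  Position g+1 with g ≤ boundary cs
-- lies below the edge to the first tree; larger positions are passed on to
-- the remaining trees.  (Positions past the end of the walk never arise; any
-- value would do there.)
insertLeaf : ℕ → List Tree → List Tree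
insertLeaf zero ts = leaf ∷ ts
insertLeaf (suc g) [] = leaf ∷ []
insertLeaf (suc g) (node cs ∷ ts) with g ≤? boundary cs
... | yes _ = node (insertLeaf g cs) ∷ ts
... | no _ = node cs ∷ insertLeaf (g ∸ suc (boundary cs)) ts

insertLeaf-inside : ∀ {g cs ts} → g ≤ boundary cs →
  insertLeaf (suc g) (node cs ∷ ts) ≡ node (insertLeaf g cs) ∷ ts
insertLeaf-inside {g} {cs} g≤ with g ≤? boundary cs
... | yes _ = refl
... | no g≰ = contradiction g≤ g≰

insertLeaf-outside : ∀ {g cs ts} → ¬ g ≤ boundary cs →
  insertLeaf (suc g) (node cs ∷ ts) ≡ node cs ∷ insertLeaf (g ∸ suc (boundary cs)) ts
insertLeaf-outside {g} {cs} g≰ with g ≤? boundary cs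
... | yes g≤ = contradiction g≤ g≰
... | no _ = refl

insertLeaf-beside : ∀ {cs ts} g →
  insertLeaf (suc (boundary cs + suc g)) (node cs ∷ ts) ≡ node cs ∷ insertLeaf g ts
insertLeaf-beside {cs} {ts} g =
  trans (insertLeaf-outside (m+1+n≰m (boundary cs)))
        (cong (λ h → node cs ∷ insertLeaf h ts)
              (trans (cong (_∸ suc (boundary cs)) (+-suc (boundary cs) g)) (m+n∸m≡n (boundary cs) g)))

boundary-insertLeaf : ∀ g ts → boundary (insertLeaf g ts) ≡ suc (suc (boundary ts))
boundary-insertLeaf zero ts = refl
boundary-insertLeaf (suc g) [] = refl
boundary-insertLeaf (suc g) (node cs ∷ ts) with g ≤? boundary cs
... | yes _ = cong (λ b → suc (b + suc (boundary ts))) (boundary-insertLeaf g cs)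
... | no _ = cong suc (trans (cong (λ b → boundary cs + suc b) (boundary-insertLeaf (g ∸ suc (boundary cs)) ts))
                             (trans (+-suc (boundary cs) _) (cong suc (+-suc (boundary cs) _))))

edges-insertLeaf : ∀ g ts → edgesF (insertLeaf g ts) ≡ suc (edgesF ts)
edges-insertLeaf zero ts = refl
edges-insertLeaf (suc g) [] = refl
edges-insertLeaf (suc g) (node cs ∷ ts) with g ≤? boundary cs
... | yes _ = cong (λ e → suc (e + edgesF ts)) (edges-insertLeaf g cs)
... | no _ = cong suc (trans (cong (edgesF cs +_) (edges-insertLeaf (g ∸ suc (boundary cs)) ts)) (+-suc (edgesF cs) _))

children : Tree → List Tree
children (node ts) = ts

-- If cs′ is cs with a leaf inserted at position g, then g is still a
-- position inside cs′, whose walk is two letters longer.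
inside-after-insertion : ∀ {g cs cs′} → node (insertLeaf g cs) ≡ node cs′ →
  g ≤ boundary cs → g ≤ boundary cs′
inside-after-insertion {g} {cs} h g≤ = ≤-trans g≤ (subst (boundary cs ≤_)
  (trans (sym (boundary-insertLeaf g cs)) (cong (boundary ∘′ children) h)) (m≤n+m _ 2))

not-single-leaf : ∀ g cs ts → leaf ∷ [] ≢ insertLeaf (suc g) (node cs ∷ ts)
not-single-leaf g cs ts e = 0≢1+n (suc-injective (suc-injective
  (trans (cong boundary e) (boundary-insertLeaf (suc g) (node cs ∷ ts)))))

insertLeaf-injective : ∀ g {ts₁ ts₂} → insertLeaf g ts₁ ≡ insertLeaf g ts₂ → ts₁ ≡ ts₂
insertLeaf-injective zero e = ∷-injectiveʳ e
insertLeaf-injective (suc g) {[]} {[]} e = refl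
insertLeaf-injective (suc g) {[]} {node cs ∷ ts} e = ⊥-elim (not-single-leaf g cs ts e)
insertLeaf-injective (suc g) {node cs ∷ ts} {[]} e = ⊥-elim (not-single-leaf g cs ts (sym e))
insertLeaf-injective (suc g) {node cs₁ ∷ ts₁} {node cs₂ ∷ ts₂} e
  with g ≤? boundary cs₁ | g ≤? boundary cs₂
... | yes _ | yes _ with ∷-injective e
...   | h , t = cong₂ (λ cs ts → node cs ∷ ts) (insertLeaf-injective g (cong children h)) t
insertLeaf-injective (suc g) {node cs ∷ _} e | no _ | no _ with ∷-injective e
... | refl , t = cong (node cs ∷_) (insertLeaf-injective (g ∸ suc (boundary cs)) t)
insertLeaf-injective (suc g) e | yes g≤ | no g≰ = contradiction (inside-after-insertion (∷-injectiveˡ e) g≤) g≰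
insertLeaf-injective (suc g) e | no g≰ | yes g≤ = contradiction (inside-after-insertion (∷-injectiveˡ (sym e)) g≤) g≰

insertLeaf-into : ∀ {cs ts} {L M : List (Letter m)} → ValidF cs (L ++ M) →
  insertLeaf (suc (length L)) (node cs ∷ ts) ≡ node (insertLeaf (length L) cs) ∷ ts
insertLeaf-into {L = L} {M} vt =
  insertLeaf-inside (subst (length L ≤_) (trans (sym (length-++ L)) (word-length vt)) (m≤m+n _ _))

insertLeaf-after : ∀ {cs ts} {w₁ : List (Letter m)} → ValidF cs w₁ → ∀ c M →
  insertLeaf (suc (length (w₁ ++ c ∷ M))) (node cs ∷ ts) ≡ node cs ∷ insertLeaf (length M) ts
insertLeaf-after {cs = cs} {ts} {w₁} vt c M =
  trans (cong (λ h → insertLeaf (suc h) (node cs ∷ ts)) (trans (length-++ w₁) (cong (_+ suc (length M)) (word-length vt))))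
        (insertLeaf-beside (length M))

insertLeaf-valid : ∀ {ts} {w : List (Letter m)} → ValidF ts w → ∀ L R → w ≡ L ++ R → ∀ y →
  ValidF (insertLeaf (length L) ts) (L ++ y ∷ comp y ∷ R)
insertLeaf-valid vnil [] [] refl y = vcons y [] [] vnil vnil
insertLeaf-valid v@(vcons _ _ _ _ _) [] R refl y = vcons y [] R vnil v
insertLeaf-valid (vcons {node cs} a w₁ w₂ vt vf) (b ∷ L) R e y with ∷-injective e
... | refl , e′ with cut-around w₁ (comp a) w₂ L R e′
... | inj₁ (M , refl , refl) =
  subst (λ f → ValidF f (a ∷ (w₁ ++ comp a ∷ M) ++ y ∷ comp y ∷ R)) (sym (insertLeaf-after vt (comp a) M))
    (vcons≡ a vt (insertLeaf-valid vf M R refl y) (sym (cong (a ∷_) (++-assoc w₁ (comp a ∷ M) _))))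
... | inj₂ (M , refl , refl) =
  subst (λ f → ValidF f (a ∷ L ++ y ∷ comp y ∷ M ++ comp a ∷ w₂)) (sym (insertLeaf-into {L = L} vt))
    (vcons≡ a (insertLeaf-valid vt L M refl y) vf (cong (a ∷_) (++-assoc L (y ∷ comp y ∷ M) _)))

last-letter-closes : ∀ {ts} {w : List (Letter m)} → ValidF ts w → ∀ M y → w ≡ M ++ [ y ] →
  ∃[ M₁ ] ∃[ M₂ ] (M ≡ M₁ ++ comp y ∷ M₂) × ∃[ cs ] ValidF cs M₂
last-letter-closes vnil [] y ()
last-letter-closes vnil (_ ∷ _) y ()
last-letter-closes (vcons {node cs} a w₁ w₂ vt vf) M y e
  with cut-around (a ∷ w₁) (comp a) w₂ M [ y ] e
... | inj₁ (N , refl , refl) with last-letter-closes vf N y refl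
...   | M₁ , M₂ , refl , below =
  a ∷ w₁ ++ comp a ∷ M₁ , M₂ , cong (a ∷_) (sym (++-assoc w₁ (comp a ∷ M₁) _)) , below
last-letter-closes (vcons {node cs} a w₁ w₂ vt vf) M y e | inj₂ ([] , p , q) with ∷-injective q
... | refl , refl = [] , w₁ , trans (sym (++-identityʳ M)) (trans (sym p) (cong (_∷ w₁) (sym comp-involutive))) , cs , vt
last-letter-closes (vcons a w₁ w₂ vt vf) M y e | inj₂ (_ ∷ [] , p , ())
last-letter-closes (vcons a w₁ w₂ vt vf) M y e | inj₂ (_ ∷ _ ∷ _ , p , ())

grow : ℕ → Tree → Tree
grow g (node ts) = node (insertLeaf g ts)

grow-injective : ∀ g {T₁ T₂} → grow g T₁ ≡ grow g T₂ → T₁ ≡ T₂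
grow-injective g {node _} {node _} e = cong node (insertLeaf-injective g (cong children e))

Enumeration : (A → Set) → ℕ → Set
Enumeration {A} S k = Σ (List A) λ as → Unique as × (length as ≡ k) × (∀ a → (a ∈ as) ⇔ S a)

image-enumeration : ∀ {S S′ : A → Set} {k} (f : A → A) → (∀ {a b} → f a ≡ f b → a ≡ b) →
  (∀ b → S′ b ⇔ (∃[ a ] S a × b ≡ f a)) → Enumeration S k → Enumeration S′ k
image-enumeration {S′ = S′} f f-injective image (as , unique , size , enum) =
  map f as , Unique.map⁺ f-injective unique , trans (length-map f as) size , λ b → mk⇔ (listed⇒S′ b) (S′⇒listed b)
  where
  listed⇒S′ : ∀ b → b ∈ map f as → S′ b
  listed⇒S′ b b∈ with ∈-map⁻ f b∈
  ... | a , a∈ , refl = Equivalence.from (image (f a)) (a , Equivalence.to (enum a) a∈ , refl)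
  S′⇒listed : ∀ b → S′ b → b ∈ map f as
  S′⇒listed b s′ with Equivalence.to (image b) s′
  ... | a , s , refl = ∈-map⁺ f (Equivalence.from (enum a) s)

vec-of-list : ∀ (xs : List A) {k} → length xs ≡ k → Σ (Vec A k) λ v → toList v ≡ xs
vec-of-list [] refl = Vec.[] , refl
vec-of-list (a ∷ xs) refl with vec-of-list xs refl
... | v , v≡xs = a Vec.∷ v , cong (a ∷_) v≡xs

length-insert-pair : ∀ (L : List A) a b R → length (L ++ a ∷ b ∷ R) ≡ 2 + length (L ++ R)
length-insert-pair [] a b R = refl
length-insert-pair (c ∷ L) a b R = cong suc (length-insert-pair L a b R)

-- Heights relative to a fixed letter x: x steps down, x̄ steps up.
module Heights {m : ℕ} (x : Letter m) where

  down up : List (Letter m) → ℕ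
  down = count x
  up = count (comp x)

  -- No suffix of L climbs: L ends at a minimum of its height profile.
  EndsLow : List (Letter m) → Set
  EndsLow L = ∀ L₁ L₂ → L ≡ L₁ ++ L₂ → up L₂ ≤ down L₂

  -- No prefix of R dips below the height R starts at.
  StaysHigh : List (Letter m) → Set
  StaysHigh R = ∀ R₁ R₂ → R ≡ R₁ ++ R₂ → down R₁ ≤ up R₁

  endsLow-[] : EndsLow []
  endsLow-[] [] [] refl = z≤n

  staysHigh-[] : StaysHigh []
  staysHigh-[] [] [] refl = z≤n

  endsLow-suffix : ∀ {L} K L₂ → L ≡ K ++ L₂ → EndsLow L → EndsLow L₂
  endsLow-suffix K L₂ refl low X Y refl = low (K ++ X) Y (sym (++-assoc K X Y))

  staysHigh-prefix : ∀ {R} R₁ K → R ≡ R₁ ++ K → StaysHigh R → StaysHigh R₁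
  staysHigh-prefix R₁ K refl high X Y refl = high X (Y ++ K) (++-assoc X Y K)

  endsLow-∷ : ∀ {a L} → up (a ∷ L) ≤ down (a ∷ L) → EndsLow L → EndsLow (a ∷ L)
  endsLow-∷ le low [] _ refl = le
  endsLow-∷ le low (_ ∷ L₁) L₂ e = low L₁ L₂ (∷-injectiveʳ e)

  -- If a ∷ L climbs strictly while L ends low, the start of a ∷ L ++ R is
  -- a new minimum: prefixes inside a ∷ L climb because the remaining suffix
  -- of L does not, and longer prefixes add a non-dipping prefix of R.
  staysHigh-∷ : ∀ {a L R} → down (a ∷ L) < up (a ∷ L) → EndsLow L → StaysHigh R →
    StaysHigh (a ∷ L ++ R)
  staysHigh-∷ lt low high [] _ _ = z≤n
  staysHigh-∷ {a} {L} {R} lt low high (b ∷ Q) R₂ e with ∷-injective e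
  ... | refl , e′ with levi L R Q R₂ e′
  ... | inj₁ (N , refl , refl) = begin
    down ((a ∷ L) ++ N)   ≡⟨ count-++ x (a ∷ L) N ⟩
    down (a ∷ L) + down N ≤⟨ +-mono-≤ (<⇒≤ lt) (high N R₂ refl) ⟩
    up (a ∷ L) + up N     ≡⟨ count-++ (comp x) (a ∷ L) N ⟨
    up ((a ∷ L) ++ N)     ∎
    where open ≤-Reasoning
  ... | inj₂ (M , refl , refl) = <⇒≤ (+-cancelʳ-< (down M) (down (a ∷ Q)) (up (a ∷ Q)) (begin-strict
    down (a ∷ Q) + down M ≡⟨ count-++ x (a ∷ Q) M ⟨
    down ((a ∷ Q) ++ M)   <⟨ lt ⟩
    up ((a ∷ Q) ++ M)     ≡⟨ count-++ (comp x) (a ∷ Q) M ⟩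
    up (a ∷ Q) + up M     ≤⟨ +-monoʳ-≤ (up (a ∷ Q)) (low Q M refl) ⟩
    up (a ∷ Q) + down M   ∎))
    where open ≤-Reasoning

  minimum-split : ∀ w → ∃[ L ] ∃[ R ] (w ≡ L ++ R) × EndsLow L × StaysHigh R
  minimum-split [] = [] , [] , refl , endsLow-[] , staysHigh-[]
  minimum-split (a ∷ w) with minimum-split w
  ... | L , R , refl , low , high with up (a ∷ L) ≤? down (a ∷ L)
  ... | yes le = a ∷ L , R , refl , endsLow-∷ le low , high
  ... | no ¬le = [] , a ∷ L ++ R , refl , endsLow-[] , staysHigh-∷ (≰⇒> ¬le) low high

  x̄-rises : ∀ {B} → down B ≤ up B → down (comp x ∷ B) < up (comp x ∷ B)
  x̄-rises {B} le = subst₂ _<_ (sym (count-cons-comp x B)) (sym (count-cons-self (comp x) B)) (s≤s le)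

  -- Hence x̄ followed by a valid (so balanced) word climbs, and cannot be a
  -- suffix of a word that ends low.
  x̄-valid-climbs : ∀ {cs B} → ValidF cs B → ¬ (up (comp x ∷ B) ≤ down (comp x ∷ B))
  x̄-valid-climbs {B = B} v = <⇒≱ (x̄-rises {B} (≤-reflexive (balanced x v)))

  insertion-complete : ∀ {ts′} {w′ : List (Letter m)} → ValidF ts′ w′ →
    ∀ L R → w′ ≡ L ++ x ∷ comp x ∷ R → EndsLow L → StaysHigh R →
    ∃[ ts ] ValidF ts (L ++ R) × (ts′ ≡ insertLeaf (length L) ts)
  insertion-complete vnil [] R () low high
  insertion-complete vnil (_ ∷ _) R () low high
  -- the inserted x x̄ label the first edge, which is a leaf
  insertion-complete (vcons {node []} {ts} a [] w₂ vnil vf) [] R e low high with ∷-injective e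
  ... | refl , e′ with ∷-injective e′
  ...   | _ , refl = ts , vf , refl
  -- the inserted x̄ would open an edge, so R would start by climbing
  insertion-complete (vcons {node cs} a (b ∷ w₁) w₂ vt vf) [] R e low high with ∷-injective e
  ... | refl , e′ with ∷-injective e′
  ...   | refl , e″ = ⊥-elim (<-irrefl (balanced x vt) (x̄-rises {w₁} (high w₁ (comp x ∷ w₂) (sym e″))))
  insertion-complete (vcons {node cs} {ts} a w₁ w₂ vt vf) (b ∷ L) R e low high with ∷-injective e
  ... | refl , e′ with cut-around-pair w₁ (comp a) w₂ L x (comp x) R e′
  ... | pair-after M refl refl
    with insertion-complete vf M R refl (endsLow-suffix (a ∷ w₁ ++ [ comp a ]) M a∷L≡ low) high
    where
    a∷L≡ : a ∷ w₁ ++ comp a ∷ M ≡ (a ∷ w₁ ++ [ comp a ]) ++ M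
    a∷L≡ = cong (a ∷_) (sym (++-assoc w₁ [ comp a ] M))
  ...   | ts₀ , v₀ , refl =
    node cs ∷ ts₀ , vcons≡ a vt v₀ (cong (a ∷_) (sym (++-assoc w₁ (comp a ∷ M) R))) ,
    sym (insertLeaf-after vt (comp a) M)
  insertion-complete (vcons {node cs} {ts} a w₁ w₂ vt vf) (b ∷ L) R e low high
    | refl , e′ | pair-before M refl refl
    with insertion-complete vt L M refl (endsLow-suffix [ a ] L refl low)
                                        (staysHigh-prefix M (comp a ∷ w₂) refl high)
  ... | cs₀ , v₀ , refl =
    node cs₀ ∷ ts , vcons≡ a v₀ vf (cong (a ∷_) (++-assoc L M _)) , sym (insertLeaf-into {L = L} v₀)
  -- the inserted x would close an edge below, ending L with x̄ and a valid word
  insertion-complete (vcons {node cs} a w₁ w₂ vt vf) (b ∷ L) R e low high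
    | refl , e′ | c-is-z refl _ _ with last-letter-closes vt L x refl
  ... | M₁ , M₂ , refl , _ , v₂ = ⊥-elim (x̄-valid-climbs v₂ (low (a ∷ M₁) (comp x ∷ M₂) refl))
  -- the inserted x would close the first edge, so L = x̄ followed by a valid word
  insertion-complete (vcons {node cs} a w₁ w₂ vt vf) (b ∷ L) R e low high
    | refl , e′ | c-is-y refl ā≡x _ with comp-swap ā≡x
  ... | refl = ⊥-elim (x̄-valid-climbs vt (low [] (a ∷ L) refl))

  valid-extension : ∀ {n L R} {w w′ : List (Letter m)} →
    w ≡ L ++ R → w′ ≡ L ++ x ∷ comp x ∷ R → EndsLow L → StaysHigh R → ∀ T′ →
    (edges T′ ≡ n + 1 × ValidT T′ w′) ⇔ (∃[ T ] (edges T ≡ n × ValidT T w) × T′ ≡ grow (length L) T)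
  valid-extension {n} {L} {R} refl refl low high (node ts′) = mk⇔ shrink extend
    where
    shrink : edges (node ts′) ≡ n + 1 × ValidF ts′ (L ++ x ∷ comp x ∷ R) →
      ∃[ T ] (edges T ≡ n × ValidT T (L ++ R)) × node ts′ ≡ grow (length L) T
    shrink (size , v′) with insertion-complete v′ L R refl low high
    ... | ts , v , ts′≡ = node ts , (suc-injective size-before , v) , cong node ts′≡
      where
      open ≡-Reasoning
      size-before : suc (edgesF ts) ≡ suc n
      size-before = begin
        suc (edgesF ts)                      ≡⟨ edges-insertLeaf (length L) ts ⟨
        edgesF (insertLeaf (length L) ts)   ≡⟨ cong edgesF ts′≡ ⟨
        edgesF ts′                           ≡⟨ size ⟩
        n + 1                                ≡⟨ +-comm n 1 ⟩
        suc n                                ∎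
    extend : ∃[ T ] (edges T ≡ n × ValidT T (L ++ R)) × node ts′ ≡ grow (length L) T →
      edges (node ts′) ≡ n + 1 × ValidF ts′ (L ++ x ∷ comp x ∷ R)
    extend (node ts , (size , v) , refl) =
      trans (edges-insertLeaf (length L) ts) (trans (cong suc size) (+-comm 1 n)) , insertLeaf-valid v L R refl x

  card-extension : ∀ {n} (P : Vec (Letter m) (2 * n)) {k} → CardV≡ n P k → ∃[ P′ ] CardV≡ (n + 1) P′ k
  card-extension {n} P enum with minimum-split (toList P)
  ... | L , R , split , low , high =
    proj₁ extended , image-enumeration (grow (length L)) (grow-injective (length L))
                       (valid-extension split (proj₂ extended) low high) enum
    where
    open ≡-Reasoning
    length-P′ : length (L ++ x ∷ comp x ∷ R) ≡ 2 * (n + 1)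
    length-P′ = begin
      length (L ++ x ∷ comp x ∷ R) ≡⟨ length-insert-pair L x (comp x) R ⟩
      2 + length (L ++ R)          ≡⟨ cong (λ w → 2 + length w) split ⟨
      2 + length (toList P)        ≡⟨ cong (2 +_) (length-toList P) ⟩
      2 + 2 * n                    ≡⟨ *-distribˡ-+ 2 1 n ⟨
      2 * (1 + n)                  ≡⟨ cong (2 *_) (+-comm 1 n) ⟩
      2 * (n + 1)                  ∎
    extended : Σ (Vec (Letter m) (2 * (n + 1))) λ P′ → toList P′ ≡ L ++ x ∷ comp x ∷ R
    extended = vec-of-list (L ++ x ∷ comp x ∷ R) length-P′

proposition2p3 : (n m : ℕ) → 1 ≤ n → 1 ≤ m →
    (k : ℕ) → InR n m k → InR (n + 1) m k
proposition2p3 n zero _ () k _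
proposition2p3 n (suc m) _ _ k (k≥1 , P , card) = k≥1 , Heights.card-extension (Fin.zero , false) P card
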